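{- Let $(\mathcal{C},P)\in\mathrm{Ob}(\mathbf{FA})$, let $S$ be the internal structure of $(\mathcal{C},P)$ and $T=\mathrm{Th}(S)$. Then the morphism $\overline{S}:(\mathcal{C}_T,P_T)\to(\mathcal{C},P)$ is part of a 2-equivalence: there is a morphism $\iota:(\mathcal{C},P)\to(\mathcal{C}_T,P_T)$ such that $\overline{S}\circ\iota$ and $\iota\circ\overline{S}$ are 2-isomorphic to the respective identity morphisms.
   Context: Syntax: first-order language $\mathscr{L}$ with quantifier symbols $\mathscr{L}_q$, connectives $\mathscr{L}_\omega$ with arities, designated $e\in\mathscr{L}_0$, $\otimes\in\mathscr{L}_2$; signatures with sorts, function symbols $f:\sigma_1..\sigma_n\to\tau$, relation symbols $R\subseteq\sigma_1..\sigma_n$; contexts, terms-in-context, formulas-in-context (from $R(\vec M)$, $M_1=_\sigma M_2$, connectives, quantifiers $\Omega_{x:\sigma}$), assertions (equations-in-context and sequents-in-context). $\mathrm{Ob}(\mathbf{FA})$: prop-categories $(\mathcal{C},P)$ ($\mathcal{C}$ with designated finite products, $P:\mathcal{C}^{op}\to\mathbf{Pos}$) with $\mathscr{L}_\omega$-algebra structures on each $P(c)$ preserved by $P(f)$, elements $Eq_c\in P(c\times c)$, maps $\Omega_{b,c}:P(b\times c)\to P(b)$ natural in $b$, such that $(P(c),\otimes,e_c)$ is a monoid, $\Omega_{b,1}\circ P(\pi_1^{b,1})=\mathrm{id}$, $\Omega_{b,c\times d}\circ P(a_{b,c,d})=\Omega_{b,c}\circ\Omega_{b\times c,d}$, $Eq_1=e_{1\times1}$,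 $Eq_{c_1\times c_2}=P(\langle\pi_1^{c_1,c_2}\pi_1,\pi_1^{c_1,c_2}\pi_2\rangle)(Eq_{c_1})\otimes P(\langle\pi_2^{c_1,c_2}\pi_1,\pi_2^{c_1,c_2}\pi_2\rangle)(Eq_{c_2})$. Structures: an $Sg$-structure $S$ assigns objects to sorts, morphisms to function symbols, elements of $P$ to relation symbols; it interprets terms $M:\tau\ [\Gamma]$ as morphisms $S[\![\Gamma]\!]\to S[\![\tau]\!]$ and formulas $\phi\ [\Gamma]$ as elements of $P(S[\![\Gamma]\!])$ in the standard way ($[\![M_1=_\tau M_2]\!]=P(\langle[\![M_1]\!],[\![M_2]\!]\rangle)Eq$, quantifiers via $\Omega_{[\![\Gamma]\!],[\![\sigma]\!]}$ after the canonical iso). $\mathrm{Th}(S)$ is the theory of all assertions satisfied by $S$ (equation: equal interpretations; sequent $\phi_1..\phi_n\vdash\phi$: $\bigotimes[\![\phi_i]\!]\le[\![\phi]\!]$, empty $\otimes=e$). Morphisms: $F=(F^o,F^p)$ with $F^o$ finite-product preserving, $F^p:P\Rightarrow QF^o$ natural, $F^p_c$ $\mathscr{L}_\omega$-homomorphisms, $F^p_b\Omega_{b,c}=\Omega_{F^ob,F^oc}Q(a_{F,b,c}^{ -1})F^p_{b\times c}$, $F^p_{c\times c}(Eq_c)=Q(a_{F,c,c})Eq_{F^oc}$ ($a_{F,b,c}$ canonical iso). Composition $(K\circ F)^o=K^oF^o$, $(K\circ F)^p_c=K^p_{F^oc}F^p_c$. 2-cells $\eta:F\Rightarrow H$: natural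 $\eta:F^o\Rightarrow H^o$ with $F^p_c=Q(\eta_c)H^p_c$; 2-isomorphism if $\eta$ invertible. Internal structure: the signature $Sg$ has the objects of $\mathcal{C}$ as sorts; for every morphism $f:c_1\times\dots\times c_n\to c$ (designated iterated product) a function symbol $f:c_1,\dots,c_n\to c$; for every $R\in P(c_1\times\dots\times c_n)$ a relation symbol $R\subseteq c_1,..,c_n$ (in particular each morphism and each element also yields a unary symbol). The internal structure $S$ interprets each sort, function symbol and relation symbol by itself. Classifying prop-category $(\mathcal{C}_T,P_T)$: objects contexts; morphisms lists of terms modulo equality in $T$, composition by substitution, products by concatenation; $P_T(\Gamma)$ formulas modulo mutual derivability in $T$, ordered by derivability; action by substitution; connectives on representatives; $\Omega_{\Gamma,\Gamma'}[\phi]=[\Omega_{y_1:\tau_1}\cdots\Omega_{y_m:\tau_m}\phi]$; $Eq_\Gamma=[x_1=_{\sigma_1}x_1'\otimes\dots\otimes x_n=_{\sigma_n}x_n']$, $Eq_{[\,]}=[e]$. The morphism $\overline{S}$: $\overline{S}^o(\Gamma)=S[\![\Gamma]\!]$, $\overline{S}^o([M_1,..,M_n])=\langle S[\![M_1]\!],..,S[\![M_n]\!]\rangle$, $\overline{S}^p_\Gamma([\phi\ [\Gamma]])=S[\![\phi\ [\Gamma]]\!]$. -}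

module Defs where

-- Quotients are modelled by setoids (hom-setoids, posets with _≈_).

open import Level using (Level; _⊔_) renaming (suc to lsuc)
open import Data.Nat using (ℕ)
open import Data.Fin using (Fin; zero; suc)
open import Data.List using (List; []; _∷_)
open import Data.Product using (Σ; _×_; _,_; proj₁; proj₂)
open import Data.Unit.Polymorphic using (⊤; tt)
open import Relation.Binary using (Rel; IsEquivalence; Poset; IsPartialOrder; IsPreorder)

record Language (ℓ : Level) : Set (lsuc ℓ) where
  field
    Quant : Set ℓ
    Conn  : ℕ → Set ℓ
    e     : Conn 0
    ⊗     : Conn 2

two : ∀ {a} {A : Set a} → A → A → Fin 2 → A
two x y zero = x
two x y (suc _) = y

-- Snoc lists (contexts / arities); the head is the LAST entry.

infixl 5 _▸_
data Ctx {ℓ : Level} (A : Set ℓ) : Set ℓ where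
  ε   : Ctx A
  _▸_ : Ctx A → A → Ctx A

infixl 4 _++_
_++_ : ∀ {ℓ} {A : Set ℓ} → Ctx A → Ctx A → Ctx A
Γ ++ ε = Γ
Γ ++ (Δ ▸ a) = (Γ ++ Δ) ▸ a

record RawCat (ℓ : Level) : Set (lsuc ℓ) where
  infixr 9 _∘_
  infixr 7 _×ᵒ_
  infix 4 _≈_
  field
    Obj   : Set ℓ
    Hom   : Obj → Obj → Set ℓ
    _≈_   : ∀ {a b} → Rel (Hom a b) ℓ
    ≈-equiv : ∀ {a b} → IsEquivalence (_≈_ {a} {b})
    id    : ∀ {a} → Hom a a
    _∘_   : ∀ {a b c} → Hom b c → Hom a b → Hom a c
    𝟙     : Obj
    _×ᵒ_  : Obj → Obj → Obj
    !     : ∀ {a} → Hom a 𝟙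
    π₁    : ∀ {a b} → Hom (a ×ᵒ b) a
    π₂    : ∀ {a b} → Hom (a ×ᵒ b) b
    ⟨_,_⟩ : ∀ {a b c} → Hom c a → Hom c b → Hom c (a ×ᵒ b)

module CatOps {ℓ} (C : RawCat ℓ) where
  open RawCat C

  ∏[_] : ∀ {A : Set ℓ} → (A → Obj) → Ctx A → Obj
  ∏[ f ] ε = 𝟙
  ∏[ f ] (ε ▸ a) = f a
  ∏[ f ] (Γ@(_ ▸ _) ▸ a) = ∏[ f ] Γ ×ᵒ f a

  _×₁_ : ∀ {a b c d} → Hom a b → Hom c d → Hom (a ×ᵒ c) (b ×ᵒ d)
  f ×₁ g = ⟨ f ∘ π₁ , g ∘ π₂ ⟩

  assocᵒ : ∀ {b c d} → Hom (b ×ᵒ (c ×ᵒ d)) ((b ×ᵒ c) ×ᵒ d)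
  assocᵒ = ⟨ ⟨ π₁ , π₁ ∘ π₂ ⟩ , π₂ ∘ π₂ ⟩

record IsCatWithProducts {ℓ} (C : RawCat ℓ) : Set ℓ where
  open RawCat C
  field
    ∘-cong : ∀ {a b c} {f f' : Hom b c} {g g' : Hom a b} → f ≈ f' → g ≈ g' → f ∘ g ≈ f' ∘ g'
    idˡ    : ∀ {a b} (f : Hom a b) → id ∘ f ≈ f
    idʳ    : ∀ {a b} (f : Hom a b) → f ∘ id ≈ f
    assoc  : ∀ {a b c d} (f : Hom a b) (g : Hom b c) (h : Hom c d) → (h ∘ g) ∘ f ≈ h ∘ (g ∘ f)
    !-unique : ∀ {a} (f : Hom a 𝟙) → f ≈ !
    π₁-β   : ∀ {a b c} (f : Hom c a) (g : Hom c b) → π₁ ∘ ⟨ f , g ⟩ ≈ f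
    π₂-β   : ∀ {a b c} (f : Hom c a) (g : Hom c b) → π₂ ∘ ⟨ f , g ⟩ ≈ g
    ⟨⟩-unique : ∀ {a b c} {f : Hom c a} {g : Hom c b} (h : Hom c (a ×ᵒ b)) →
                π₁ ∘ h ≈ f → π₂ ∘ h ≈ g → h ≈ ⟨ f , g ⟩

module _ {ℓ} (L : Language ℓ) (C : RawCat ℓ) where
  open Language L
  open RawCat C
  record PropStructure : Set (lsuc ℓ) where
    field
      P   : Obj → Poset ℓ ℓ ℓ
      act : ∀ {a b} → Hom a b → Poset.Carrier (P b) → Poset.Carrier (P a)
      op  : ∀ {c n} → Conn n → (Fin n → Poset.Carrier (P c)) → Poset.Carrier (P c)
      Eq  : ∀ c → Poset.Carrier (P (c ×ᵒ c))
      Ω   : Quant → ∀ b c → Poset.Carrier (P (b ×ᵒ c)) → Poset.Carrier (P b)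

record RawPropCat {ℓ} (L : Language ℓ) : Set (lsuc ℓ) where
  field
    cat  : RawCat ℓ
    prop : PropStructure L cat

module RPC {ℓ} {L : Language ℓ} (A : RawPropCat L) where
  open RawPropCat A public
  open RawCat cat public
  open CatOps cat public
  open PropStructure prop public
  open Language L using (e; ⊗)

  ∣_∣ : Obj → Set ℓ
  ∣ c ∣ = Poset.Carrier (P c)

  infix 4 _≤ₚ_ _≈ₚ_
  _≤ₚ_ : ∀ {c} → Rel ∣ c ∣ ℓ
  _≤ₚ_ {c} = Poset._≤_ (P c)

  _≈ₚ_ : ∀ {c} → Rel ∣ c ∣ ℓ
  _≈ₚ_ {c} = Poset._≈_ (P c)

  infixl 6 _⊗ₚ_
  _⊗ₚ_ : ∀ {c} → ∣ c ∣ → ∣ c ∣ → ∣ c ∣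
  x ⊗ₚ y = op ⊗ (two x y)

  eₚ : ∀ {c} → ∣ c ∣
  eₚ = op e (λ ())

  ⨂ : ∀ {c} → List ∣ c ∣ → ∣ c ∣
  ⨂ [] = eₚ
  ⨂ (x ∷ []) = x
  ⨂ (x ∷ xs@(_ ∷ _)) = x ⊗ₚ ⨂ xs

record IsFA {ℓ} {L : Language ℓ} (A : RawPropCat L) : Set (lsuc ℓ) where
  open Language L
  open RPC A
  field
    isCat    : IsCatWithProducts cat
    act-cong : ∀ {a b} {f g : Hom a b} → f ≈ g → ∀ x → act f x ≈ₚ act g x
    act-id   : ∀ {c} (x : ∣ c ∣) → act id x ≈ₚ x
    act-∘    : ∀ {a b c} (f : Hom a b) (g : Hom b c) x → act (g ∘ f) x ≈ₚ act f (act g x)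
    act-mono : ∀ {a b} (f : Hom a b) {x y} → x ≤ₚ y → act f x ≤ₚ act f y
    op-cong  : ∀ {c n} (k : Conn n) {xs ys : Fin n → ∣ c ∣} → (∀ i → xs i ≈ₚ ys i) → op k xs ≈ₚ op k ys
    act-op   : ∀ {a b n} (f : Hom a b) (k : Conn n) xs → act f (op k xs) ≈ₚ op k (λ i → act f (xs i))
    Ω-cong   : ∀ q {b c} {x y : ∣ b ×ᵒ c ∣} → x ≈ₚ y → Ω q b c x ≈ₚ Ω q b c y
    Ω-nat    : ∀ q {b' b c} (f : Hom b' b) (x : ∣ b ×ᵒ c ∣) →
               Ω q b' c (act (f ×₁ id) x) ≈ₚ act f (Ω q b c x)
    ⊗-assoc  : ∀ {c} (x y z : ∣ c ∣) → (x ⊗ₚ y) ⊗ₚ z ≈ₚ x ⊗ₚ (y ⊗ₚ z)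
    ⊗-idˡ    : ∀ {c} (x : ∣ c ∣) → eₚ ⊗ₚ x ≈ₚ x
    ⊗-idʳ    : ∀ {c} (x : ∣ c ∣) → x ⊗ₚ eₚ ≈ₚ x
    Ω-unit   : ∀ q {b} (x : ∣ b ∣) → Ω q b 𝟙 (act π₁ x) ≈ₚ x
    Ω-assoc  : ∀ q {b c d} (x : ∣ (b ×ᵒ c) ×ᵒ d ∣) →
               Ω q b (c ×ᵒ d) (act assocᵒ x) ≈ₚ Ω q b c (Ω q (b ×ᵒ c) d x)
    Eq-𝟙     : Eq 𝟙 ≈ₚ eₚ
    Eq-×     : ∀ {c₁ c₂} → Eq (c₁ ×ᵒ c₂) ≈ₚ
               act ⟨ π₁ ∘ π₁ , π₁ ∘ π₂ ⟩ (Eq c₁) ⊗ₚ act ⟨ π₂ ∘ π₁ , π₂ ∘ π₂ ⟩ (Eq c₂)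

module _ {ℓ} {L : Language ℓ} where

  record RawMorphism (A B : RawPropCat L) : Set ℓ where
    private
      module A = RPC A
      module B = RPC B
    field
      Fo : A.Obj → B.Obj
      Fh : ∀ {a b} → A.Hom a b → B.Hom (Fo a) (Fo b)
      Fp : ∀ {c} → A.∣ c ∣ → B.∣ Fo c ∣

  record IsMorphism {A B : RawPropCat L} (F : RawMorphism A B) : Set ℓ where
    private
      module A = RPC A
      module B = RPC B
    open Language L
    open RawMorphism F
    canon : ∀ b c → B.Hom (Fo (b A.×ᵒ c)) (Fo b B.×ᵒ Fo c)
    canon b c = B.⟨ Fh A.π₁ , Fh A.π₂ ⟩
    field
      Fh-cong : ∀ {a b} {f g : A.Hom a b} → f A.≈ g → Fh f B.≈ Fh g
      Fh-id   : ∀ {a} → Fh (A.id {a}) B.≈ B.id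
      Fh-∘    : ∀ {a b c} (f : A.Hom a b) (g : A.Hom b c) → Fh (g A.∘ f) B.≈ Fh g B.∘ Fh f
      𝟙-inv   : B.Hom B.𝟙 (Fo A.𝟙)
      𝟙-inv-l : B.! B.∘ 𝟙-inv B.≈ B.id
      𝟙-inv-r : 𝟙-inv B.∘ B.! B.≈ B.id
      ×-inv   : ∀ b c → B.Hom (Fo b B.×ᵒ Fo c) (Fo (b A.×ᵒ c))
      ×-inv-l : ∀ b c → canon b c B.∘ ×-inv b c B.≈ B.id
      ×-inv-r : ∀ b c → ×-inv b c B.∘ canon b c B.≈ B.id
      Fp-mono : ∀ {c} {x y : A.∣ c ∣} → x A.≤ₚ y → Fp x B.≤ₚ Fp y
      Fp-nat  : ∀ {a b} (f : A.Hom a b) (x : A.∣ b ∣) → Fp (A.act f x) B.≈ₚ B.act (Fh f) (Fp x)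
      Fp-op   : ∀ {c n} (k : Conn n) (xs : Fin n → A.∣ c ∣) → Fp (A.op k xs) B.≈ₚ B.op k (λ i → Fp (xs i))
      Fp-Ω    : ∀ q b c (x : A.∣ b A.×ᵒ c ∣) →
                Fp (A.Ω q b c x) B.≈ₚ B.Ω q (Fo b) (Fo c) (B.act (×-inv b c) (Fp x))
      Fp-Eq   : ∀ c → Fp (A.Eq c) B.≈ₚ B.act (canon c c) (B.Eq (Fo c))

  idᴹ : {A : RawPropCat L} → RawMorphism A A
  idᴹ = record { Fo = λ c → c ; Fh = λ f → f ; Fp = λ x → x }

  infixr 9 _∘ᴹ_
  _∘ᴹ_ : {A B C : RawPropCat L} → RawMorphism B C → RawMorphism A B → RawMorphism A C
  K ∘ᴹ F = record
    { Fo = λ c → K.Fo (F.Fo c)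
    ; Fh = λ f → K.Fh (F.Fh f)
    ; Fp = λ x → K.Fp (F.Fp x) }
    where
      module K = RawMorphism K
      module F = RawMorphism F

  record TwoIso {A B : RawPropCat L} (F H : RawMorphism A B) : Set ℓ where
    private
      module A = RPC A
      module B = RPC B
      module F = RawMorphism F
      module H = RawMorphism H
    field
      η      : ∀ c → B.Hom (F.Fo c) (H.Fo c)
      η-nat  : ∀ {a b} (f : A.Hom a b) → H.Fh f B.∘ η a B.≈ η b B.∘ F.Fh f
      η-p    : ∀ c (x : A.∣ c ∣) → F.Fp x B.≈ₚ B.act (η c) (H.Fp x)
      η⁻¹    : ∀ c → B.Hom (H.Fo c) (F.Fo c)
      η⁻¹∘η  : ∀ c → η⁻¹ c B.∘ η c B.≈ B.id
      η∘η⁻¹  : ∀ c → η c B.∘ η⁻¹ c B.≈ B.id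

record Signature (ℓ : Level) : Set (lsuc ℓ) where
  field
    Sort : Set ℓ
    Fun  : Ctx Sort → Sort → Set ℓ
    Rel' : Ctx Sort → Set ℓ

module Syntax {ℓ} (L : Language ℓ) (Sg : Signature ℓ) where
  open Language L
  open Signature Sg

  data Var : Ctx Sort → Sort → Set ℓ where
    here  : ∀ {Γ σ} → Var (Γ ▸ σ) σ
    there : ∀ {Γ σ τ} → Var Γ σ → Var (Γ ▸ τ) σ

  mutual
    data Term (Γ : Ctx Sort) : Sort → Set ℓ where
      var : ∀ {σ} → Var Γ σ → Term Γ σ
      app : ∀ {Δ τ} → Fun Δ τ → Terms Γ Δ → Term Γ τ

    data Terms (Γ : Ctx Sort) : Ctx Sort → Set ℓ where
      ε   : Terms Γ ε
      _▸_ : ∀ {Δ σ} → Terms Γ Δ → Term Γ σ → Terms Γ (Δ ▸ σ)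

  data Formula : Ctx Sort → Set ℓ where
    rel   : ∀ {Γ Δ} → Rel' Δ → Terms Γ Δ → Formula Γ
    eq    : ∀ {Γ} σ → Term Γ σ → Term Γ σ → Formula Γ
    con   : ∀ {Γ n} → Conn n → (Fin n → Formula Γ) → Formula Γ
    quant : ∀ {Γ} → Quant → ∀ σ → Formula (Γ ▸ σ) → Formula Γ

  data Assertion : Set ℓ where
    equation : ∀ Γ σ → Term Γ σ → Term Γ σ → Assertion
    sequent  : ∀ Γ → List (Formula Γ) → Formula Γ → Assertion

  Theory : Set (lsuc ℓ)
  Theory = Assertion → Set ℓ

  Ren : Ctx Sort → Ctx Sort → Set ℓ
  Ren Γ Γ' = ∀ {σ} → Var Γ σ → Var Γ' σ

  mutual
    ren : ∀ {Γ Γ' σ} → Ren Γ Γ' → Term Γ σ → Term Γ' σ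
    ren ρ (var x) = var (ρ x)
    ren ρ (app f Ms) = app f (rens ρ Ms)

    rens : ∀ {Γ Γ' Δ} → Ren Γ Γ' → Terms Γ Δ → Terms Γ' Δ
    rens ρ ε = ε
    rens ρ (Ms ▸ M) = rens ρ Ms ▸ ren ρ M

  lookup : ∀ {Γ Δ σ} → Terms Γ Δ → Var Δ σ → Term Γ σ
  lookup (Ms ▸ M) here = M
  lookup (Ms ▸ M) (there x) = lookup Ms x

  mutual
    sub : ∀ {Γ Δ σ} → Terms Γ Δ → Term Δ σ → Term Γ σ
    sub f (var x) = lookup f x
    sub f (app g Ms) = app g (subs f Ms)

    subs : ∀ {Γ Δ Θ} → Terms Γ Δ → Terms Δ Θ → Terms Γ Θ
    subs f ε = ε
    subs f (Ms ▸ M) = subs f Ms ▸ sub f M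

  liftS : ∀ {Γ Δ σ} → Terms Γ Δ → Terms (Γ ▸ σ) (Δ ▸ σ)
  liftS f = rens there f ▸ var here

  subF : ∀ {Γ Δ} → Terms Γ Δ → Formula Δ → Formula Γ
  subF f (rel R Ms) = rel R (subs f Ms)
  subF f (eq σ M N) = eq σ (sub f M) (sub f N)
  subF f (con k φs) = con k (λ i → subF f (φs i))
  subF f (quant q σ φ) = quant q σ (subF (liftS f) φ)

  vars : ∀ {Γ} Δ → Ren Δ Γ → Terms Γ Δ
  vars ε ρ = ε
  vars (Δ ▸ σ) ρ = vars Δ (λ x → ρ (there x)) ▸ var (ρ here)

  inl : ∀ {Γ} Δ → Ren Γ (Γ ++ Δ)
  inl ε x = x
  inl (Δ ▸ _) x = there (inl Δ x)

  inr : ∀ {Γ} Δ → Ren Δ (Γ ++ Δ)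
  inr (Δ ▸ _) here = here
  inr (Δ ▸ _) (there x) = there (inr Δ x)

  _++ₜ_ : ∀ {Γ Δ Δ'} → Terms Γ Δ → Terms Γ Δ' → Terms Γ (Δ ++ Δ')
  f ++ₜ ε = f
  f ++ₜ (g ▸ M) = (f ++ₜ g) ▸ M

  _⊗F_ : ∀ {Γ} → Formula Γ → Formula Γ → Formula Γ
  φ ⊗F ψ = con ⊗ (two φ ψ)

  eF : ∀ {Γ} → Formula Γ
  eF = con e (λ ())

  eqF : ∀ {Θ} Δ → Ren Δ Θ → Ren Δ Θ → Formula Θ
  eqF ε ρ₁ ρ₂ = eF
  eqF (ε ▸ σ) ρ₁ ρ₂ = eq σ (var (ρ₁ here)) (var (ρ₂ here))
  eqF (Δ@(_ ▸ _) ▸ σ) ρ₁ ρ₂ =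
    eqF Δ (λ x → ρ₁ (there x)) (λ x → ρ₂ (there x)) ⊗F eq σ (var (ρ₁ here)) (var (ρ₂ here))

  EqF : ∀ Γ → Formula (Γ ++ Γ)
  EqF Γ = eqF Γ (inl Γ) (inr Γ)

  quantAll : Quant → ∀ Γ Γ' → Formula (Γ ++ Γ') → Formula Γ
  quantAll q Γ ε φ = φ
  quantAll q Γ (Γ' ▸ τ) φ = quantAll q Γ Γ' (quant q τ φ)

  -- Classifying prop-category of a theory T.  "Derivable in T" is read
  -- as membership in T; the closure properties below are exactly what is
  -- needed for the hom-setoids and the posets P_T(Γ).

  record Closure (T : Theory) : Set ℓ where
    field
      eq-refl  : ∀ {Γ σ} (M : Term Γ σ) → T (equation Γ σ M M)
      eq-sym   : ∀ {Γ σ} {M N : Term Γ σ} → T (equation Γ σ M N) → T (equation Γ σ N M)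
      eq-trans : ∀ {Γ σ} {M N K : Term Γ σ} → T (equation Γ σ M N) → T (equation Γ σ N K) → T (equation Γ σ M K)
      seq-refl : ∀ {Γ} (φ : Formula Γ) → T (sequent Γ (φ ∷ []) φ)
      seq-trans : ∀ {Γ} {φ ψ χ : Formula Γ} → T (sequent Γ (φ ∷ []) ψ) → T (sequent Γ (ψ ∷ []) χ) → T (sequent Γ (φ ∷ []) χ)

  module Classifying (T : Theory) (cl : Closure T) where
    open Closure cl

    TEq : ∀ {Γ Δ} → Terms Γ Δ → Terms Γ Δ → Set ℓ
    TEq ε ε = ⊤
    TEq {Γ} (_▸_ {σ = σ} Ms M) (Ns ▸ N) = TEq Ms Ns × T (equation Γ σ M N)

    TEq-refl : ∀ {Γ Δ} (f : Terms Γ Δ) → TEq f f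
    TEq-refl ε = tt
    TEq-refl (f ▸ M) = TEq-refl f , eq-refl M

    TEq-sym : ∀ {Γ Δ} {f g : Terms Γ Δ} → TEq f g → TEq g f
    TEq-sym {f = ε} {ε} _ = tt
    TEq-sym {f = f ▸ M} {g ▸ N} (p , q) = TEq-sym p , eq-sym q

    TEq-trans : ∀ {Γ Δ} {f g h : Terms Γ Δ} → TEq f g → TEq g h → TEq f h
    TEq-trans {f = ε} {ε} {ε} _ _ = tt
    TEq-trans {f = f ▸ M} {g ▸ N} {h ▸ K} (p , q) (p' , q') = TEq-trans p p' , eq-trans q q'

    catT : RawCat ℓ
    catT = record
      { Obj = Ctx Sort
      ; Hom = Terms
      ; _≈_ = TEq
      ; ≈-equiv = record { refl = TEq-refl _ ; sym = TEq-sym ; trans = TEq-trans }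
      ; id = λ {Γ} → vars Γ (λ x → x)
      ; _∘_ = λ g f → subs f g
      ; 𝟙 = ε
      ; _×ᵒ_ = _++_
      ; ! = ε
      ; π₁ = λ {Γ} {Δ} → vars Γ (inl Δ)
      ; π₂ = λ {Γ} {Δ} → vars Δ (inr Δ)
      ; ⟨_,_⟩ = _++ₜ_
      }

    _⊢_ : ∀ {Γ} → Formula Γ → Formula Γ → Set ℓ
    _⊢_ {Γ} φ ψ = T (sequent Γ (φ ∷ []) ψ)

    PT : Ctx Sort → Poset ℓ ℓ ℓ
    PT Γ = record
      { Carrier = Formula Γ
      ; _≈_ = λ φ ψ → (φ ⊢ ψ) × (ψ ⊢ φ)
      ; _≤_ = _⊢_
      ; isPartialOrder = record
        { isPreorder = record
          { isEquivalence = record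
            { refl = seq-refl _ , seq-refl _
            ; sym = λ { (p , q) → q , p }
            ; trans = λ { (p , q) (p' , q') → seq-trans p p' , seq-trans q' q } }
          ; reflexive = proj₁
          ; trans = seq-trans }
        ; antisym = _,_ } }

    ClassifyingPropCat : RawPropCat L
    ClassifyingPropCat = record
      { cat = catT
      ; prop = record
        { P = PT
        ; act = subF
        ; op = con
        ; Eq = EqF
        ; Ω = λ q Γ Γ' φ → quantAll q Γ Γ' φ } }

record Structure {ℓ} {L : Language ℓ} (Sg : Signature ℓ) (A : RawPropCat L) : Set ℓ where
  open Signature Sg
  open RPC A
  field
    sortI : Sort → Obj
    funI  : ∀ {Δ τ} → Fun Δ τ → Hom (∏[ sortI ] Δ) (sortI τ)
    relI  : ∀ {Δ} → Rel' Δ → ∣ ∏[ sortI ] Δ ∣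

module Interp {ℓ} {L : Language ℓ} {Sg : Signature ℓ} {A : RawPropCat L} (S : Structure Sg A) where
  open Signature Sg
  open RPC A
  open Structure S
  open Syntax L Sg

  ⟦_⟧c : Ctx Sort → Obj
  ⟦ Γ ⟧c = ∏[ sortI ] Γ

  proj : ∀ {Γ σ} → Var Γ σ → Hom ⟦ Γ ⟧c (sortI σ)
  proj {ε ▸ _} here = id
  proj {ε ▸ _} (there ())
  proj {(_ ▸ _) ▸ _} here = π₂
  proj {(_ ▸ _) ▸ _} (there x) = proj x ∘ π₁

  mutual
    ⟦_⟧t : ∀ {Γ σ} → Term Γ σ → Hom ⟦ Γ ⟧c (sortI σ)
    ⟦ var x ⟧t = proj x
    ⟦ app f Ms ⟧t = funI f ∘ ⟦ Ms ⟧ts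

    ⟦_⟧ts : ∀ {Γ Δ} → Terms Γ Δ → Hom ⟦ Γ ⟧c ⟦ Δ ⟧c
    ⟦ ε ⟧ts = !
    ⟦ ε ▸ M ⟧ts = ⟦ M ⟧t
    ⟦ Ms@(_ ▸ _) ▸ M ⟧ts = ⟨ ⟦ Ms ⟧ts , ⟦ M ⟧t ⟩

  ext : ∀ Γ σ → Hom (⟦ Γ ⟧c ×ᵒ sortI σ) ⟦ Γ ▸ σ ⟧c
  ext ε σ = π₂
  ext (_ ▸ _) σ = id

  ⟦_⟧f : ∀ {Γ} → Formula Γ → ∣ ⟦ Γ ⟧c ∣
  ⟦ rel R Ms ⟧f = act ⟦ Ms ⟧ts (relI R)
  ⟦ eq σ M N ⟧f = act ⟨ ⟦ M ⟧t , ⟦ N ⟧t ⟩ (Eq (sortI σ))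
  ⟦ con k φs ⟧f = op k (λ i → ⟦ φs i ⟧f)
  ⟦ quant {Γ} q σ φ ⟧f = Ω q ⟦ Γ ⟧c (sortI σ) (act (ext Γ σ) ⟦ φ ⟧f)

  ⟦_⟧l : ∀ {Γ} → List (Formula Γ) → List ∣ ⟦ Γ ⟧c ∣
  ⟦ [] ⟧l = []
  ⟦ φ ∷ φs ⟧l = ⟦ φ ⟧f ∷ ⟦ φs ⟧l

  Th : Theory
  Th (equation Γ σ M N) = ⟦ M ⟧t ≈ ⟦ N ⟧t
  Th (sequent Γ φs φ) = ⨂ ⟦ φs ⟧l ≤ₚ ⟦ φ ⟧f

  Th-closure : Closure Th
  Th-closure = record
    { eq-refl = λ M → IsEquivalence.refl ≈-equiv
    ; eq-sym = IsEquivalence.sym ≈-equiv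
    ; eq-trans = IsEquivalence.trans ≈-equiv
    ; seq-refl = λ {Γ} φ → Poset.refl (P ⟦ Γ ⟧c)
    ; seq-trans = λ {Γ} → Poset.trans (P ⟦ Γ ⟧c) }

module Internal {ℓ} {L : Language ℓ} (A : RawPropCat L) where
  open RPC A

  IntSig : Signature ℓ
  IntSig = record
    { Sort = Obj
    ; Fun = λ Δ c → Hom (∏[ (λ x → x) ] Δ) c
    ; Rel' = λ Δ → ∣ ∏[ (λ x → x) ] Δ ∣ }

  IntStr : Structure IntSig A
  IntStr = record { sortI = λ x → x ; funI = λ f → f ; relI = λ R → R }

  open Syntax L IntSig
  open Interp IntStr

  CT : RawPropCat L
  CT = Classifying.ClassifyingPropCat Th Th-closure

  Sbar : RawMorphism CT A
  Sbar = record { Fo = ⟦_⟧c ; Fh = ⟦_⟧ts ; Fp = ⟦_⟧f }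

{-# OPTIONS --safe #-}
-- Since T = Th(S), two terms are equal in T exactly when their interpretations
-- are equal, and φ ⊢ ψ holds in T exactly when ⟦φ⟧ ≤ ⟦ψ⟧.  Every statement about
-- (C_T, P_T) therefore becomes a statement about interpretations, and the one
-- substantial fact needed is soundness of substitution: ⟦φ[g]⟧ = P(⟦g⟧)⟦φ⟧.
-- The inverse ι sends c to the one-variable context (x : c), f to f(x) and R
-- to R(x), so that S̄ ∘ ι is the identity on the nose.  Conversely a context Γ
-- is isomorphic in C_T to (x : ⟦Γ⟧), via the projection terms πᵢ(x) one way and
-- the term id(x₁, …, xₙ) the other way; both are interpreted by identities.
module Submission where

open import Defs
open import Level using (Level)
open import Data.Product using (Σ; _×_; _,_)
open import Data.Unit.Polymorphic using (tt)
open import Relation.Binary using (Setoid; IsEquivalence; Poset)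
open import Relation.Binary.PropositionalEquality as ≡ using (_≡_)
import Relation.Binary.Reasoning.Setoid as SetoidReasoning

module ProductLemmas {ℓ} (C : RawCat ℓ) (isCat : IsCatWithProducts C) where
  open RawCat C
  open CatOps C
  open IsCatWithProducts isCat
  open module ≈ {a b} = IsEquivalence (≈-equiv {a} {b})
    using () renaming (refl to ≈-refl; sym to ≈-sym; trans to ≈-trans; reflexive to ≈-reflexive) public

  homSetoid : Obj → Obj → Setoid ℓ ℓ
  homSetoid a b = record { Carrier = Hom a b ; _≈_ = _≈_ ; isEquivalence = ≈-equiv }

  module HomReasoning {a b : Obj} = SetoidReasoning (homSetoid a b)

  ∘-congˡ : ∀ {a b c} {f f' : Hom b c} {g : Hom a b} → f ≈ f' → f ∘ g ≈ f' ∘ g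
  ∘-congˡ p = ∘-cong p ≈-refl

  ∘-congʳ : ∀ {a b c} {f : Hom b c} {g g' : Hom a b} → g ≈ g' → f ∘ g ≈ f ∘ g'
  ∘-congʳ p = ∘-cong ≈-refl p

  ⟨⟩-cong : ∀ {a b c} {f f' : Hom c a} {g g' : Hom c b} → f ≈ f' → g ≈ g' → ⟨ f , g ⟩ ≈ ⟨ f' , g' ⟩
  ⟨⟩-cong p q = ⟨⟩-unique _ (≈-trans (π₁-β _ _) p) (≈-trans (π₂-β _ _) q)

  ⟨⟩-∘ : ∀ {a b c d} (f : Hom c a) (g : Hom c b) (h : Hom d c) → ⟨ f , g ⟩ ∘ h ≈ ⟨ f ∘ h , g ∘ h ⟩
  ⟨⟩-∘ f g h = ⟨⟩-unique _ (≈-trans (≈-sym (assoc h _ π₁)) (∘-congˡ (π₁-β f g)))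
                           (≈-trans (≈-sym (assoc h _ π₂)) (∘-congˡ (π₂-β f g)))

  ⟨π₁,π₂⟩≈id : ∀ {a b} → ⟨ π₁ , π₂ ⟩ ≈ id {a ×ᵒ b}
  ⟨π₁,π₂⟩≈id = ≈-sym (⟨⟩-unique id (idʳ π₁) (idʳ π₂))

  ⟨id∘π₁,π₂⟩≈id : ∀ {a b} → ⟨ id ∘ π₁ , π₂ ⟩ ≈ id {a ×ᵒ b}
  ⟨id∘π₁,π₂⟩≈id = ≈-trans (⟨⟩-cong (idˡ π₁) ≈-refl) ⟨π₁,π₂⟩≈id

module SubstitutionLemmas {ℓ} (L : Language ℓ) (Sg : Signature ℓ) where
  open Signature Sg
  open Syntax L Sg

  lookup-vars : ∀ {Γ} Δ (ρ : Ren Δ Γ) {σ} (x : Var Δ σ) → lookup (vars Δ ρ) x ≡ var (ρ x)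
  lookup-vars (Δ ▸ σ) ρ here = ≡.refl
  lookup-vars (Δ ▸ σ) ρ (there x) = lookup-vars Δ (λ y → ρ (there y)) x

  mutual
    ren≡sub-vars : ∀ {Γ Γ' σ} (ρ : Ren Γ Γ') (M : Term Γ σ) → ren ρ M ≡ sub (vars Γ ρ) M
    ren≡sub-vars {Γ} ρ (var x) = ≡.sym (lookup-vars Γ ρ x)
    ren≡sub-vars ρ (app f Ms) = ≡.cong (app f) (rens≡subs-vars ρ Ms)

    rens≡subs-vars : ∀ {Γ Γ' Δ} (ρ : Ren Γ Γ') (Ms : Terms Γ Δ) → rens ρ Ms ≡ subs (vars Γ ρ) Ms
    rens≡subs-vars ρ ε = ≡.refl
    rens≡subs-vars ρ (Ms ▸ M) = ≡.cong₂ _▸_ (rens≡subs-vars ρ Ms) (ren≡sub-vars ρ M)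

  tabulate : ∀ {Θ} Δ → (∀ {σ} → Var Δ σ → Term Θ σ) → Terms Θ Δ
  tabulate ε t = ε
  tabulate (Δ ▸ σ) t = tabulate Δ (λ x → t (there x)) ▸ t here

  lookup-tabulate : ∀ {Θ} Δ (t : ∀ {σ} → Var Δ σ → Term Θ σ) {σ} (x : Var Δ σ) →
                    lookup (tabulate Δ t) x ≡ t x
  lookup-tabulate (Δ ▸ σ) t here = ≡.refl
  lookup-tabulate (Δ ▸ σ) t (there x) = lookup-tabulate Δ (λ y → t (there y)) x

module Soundness {ℓ} {L : Language ℓ} {Sg : Signature ℓ} (A : RawPropCat L) (fa : IsFA A)
                 (S : Structure Sg A) where
  open RPC A
  open IsFA fa
  open IsCatWithProducts isCat
  open ProductLemmas cat isCat
  open Signature Sg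
  open Syntax L Sg
  open SubstitutionLemmas L Sg
  open Structure S using (sortI; funI; relI)
  open Interp S

  module ≈ₚ {c : Obj} = Poset.Eq (P c)
  module PReasoning {c : Obj} = SetoidReasoning (≈ₚ.setoid {c})

  act-resp-≈ₚ : ∀ {a b} (f : Hom a b) {x y : ∣ b ∣} → x ≈ₚ y → act f x ≈ₚ act f y
  act-resp-≈ₚ {a} {b} f p =
    Poset.antisym (P a) (act-mono f (Poset.reflexive (P b) p))
                        (act-mono f (Poset.reflexive (P b) (≈ₚ.sym p)))

  proj-ext : ∀ Δ {X} {h k : Hom X ⟦ Δ ⟧c} → (∀ {σ} (x : Var Δ σ) → proj x ∘ h ≈ proj x ∘ k) → h ≈ k
  proj-ext ε {h = h} {k} _ = ≈-trans (!-unique h) (≈-sym (!-unique k))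
  proj-ext (ε ▸ σ) {h = h} {k} p = ≈-trans (≈-sym (idˡ h)) (≈-trans (p here) (idˡ k))
  proj-ext ((Δ ▸ τ) ▸ σ) {h = h} {k} p =
    ≈-trans (⟨⟩-unique h (proj-ext (Δ ▸ τ) on-π₁) (p here)) (≈-sym (⟨⟩-unique k ≈-refl ≈-refl))
    where
      on-π₁ : ∀ {ρ} (x : Var (Δ ▸ τ) ρ) → proj x ∘ (π₁ ∘ h) ≈ proj x ∘ (π₁ ∘ k)
      on-π₁ x = ≈-trans (≈-sym (assoc h π₁ (proj x))) (≈-trans (p (there x)) (assoc k π₁ (proj x)))

  ⟦lookup⟧ : ∀ {Γ Δ σ} (g : Terms Γ Δ) (x : Var Δ σ) → proj x ∘ ⟦ g ⟧ts ≈ ⟦ lookup g x ⟧t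
  ⟦lookup⟧ (ε ▸ M) here = idˡ _
  ⟦lookup⟧ ((g ▸ N) ▸ M) here = π₂-β _ _
  ⟦lookup⟧ ((g ▸ N) ▸ M) (there x) =
    ≈-trans (assoc _ π₁ (proj x)) (≈-trans (∘-congʳ (π₁-β _ _)) (⟦lookup⟧ (g ▸ N) x))

  mutual
    ⟦sub⟧ : ∀ {Γ Δ σ} (g : Terms Γ Δ) (M : Term Δ σ) → ⟦ sub g M ⟧t ≈ ⟦ M ⟧t ∘ ⟦ g ⟧ts
    ⟦sub⟧ g (var x) = ≈-sym (⟦lookup⟧ g x)
    ⟦sub⟧ g (app f Ms) = ≈-trans (∘-congʳ (⟦subs⟧ g Ms)) (≈-sym (assoc _ _ (funI f)))

    ⟦subs⟧ : ∀ {Γ Δ Θ} (g : Terms Γ Δ) (f : Terms Δ Θ) → ⟦ subs g f ⟧ts ≈ ⟦ f ⟧ts ∘ ⟦ g ⟧ts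
    ⟦subs⟧ g ε = ≈-sym (!-unique _)
    ⟦subs⟧ g (ε ▸ M) = ⟦sub⟧ g M
    ⟦subs⟧ g ((f ▸ N) ▸ M) =
      ≈-trans (⟨⟩-cong (⟦subs⟧ g (f ▸ N)) (⟦sub⟧ g M)) (≈-sym (⟨⟩-∘ _ _ _))

  ⟦rens⟧ : ∀ {Γ Γ' Δ} (ρ : Ren Γ Γ') (Ms : Terms Γ Δ) → ⟦ rens ρ Ms ⟧ts ≈ ⟦ Ms ⟧ts ∘ ⟦ vars Γ ρ ⟧ts
  ⟦rens⟧ ρ Ms = ≈-trans (≈-reflexive (≡.cong ⟦_⟧ts (rens≡subs-vars ρ Ms))) (⟦subs⟧ _ Ms)

  ⟦vars⟧ : ∀ {Γ} Δ (ρ : Ren Δ Γ) {σ} (x : Var Δ σ) → proj x ∘ ⟦ vars Δ ρ ⟧ts ≈ proj (ρ x)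
  ⟦vars⟧ Δ ρ x = ≈-trans (⟦lookup⟧ (vars Δ ρ) x) (≈-reflexive (≡.cong ⟦_⟧t (lookup-vars Δ ρ x)))

  ⟦vars-id⟧ : ∀ Γ → ⟦ vars Γ (λ x → x) ⟧ts ≈ id
  ⟦vars-id⟧ Γ = proj-ext Γ λ x → ≈-trans (⟦vars⟧ Γ _ x) (≈-sym (idʳ _))

  ⟦snoc⟧ : ∀ {Γ Δ σ} (Ms : Terms Γ Δ) (M : Term Γ σ) → ⟦ Ms ▸ M ⟧ts ≈ ext Δ σ ∘ ⟨ ⟦ Ms ⟧ts , ⟦ M ⟧t ⟩
  ⟦snoc⟧ ε M = ≈-sym (π₂-β _ _)
  ⟦snoc⟧ (Ms ▸ N) M = ≈-sym (idˡ _)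

  proj-here∘ext : ∀ Γ σ → proj {Γ ▸ σ} here ∘ ext Γ σ ≈ π₂
  proj-here∘ext ε σ = idˡ π₂
  proj-here∘ext (Γ ▸ τ) σ = idʳ π₂

  proj-there∘ext : ∀ Γ σ {τ} (x : Var Γ τ) → proj {Γ ▸ σ} (there x) ∘ ext Γ σ ≈ proj x ∘ π₁
  proj-there∘ext (Γ ▸ ρ) σ x = idʳ _

  ⟦weaken⟧∘ext : ∀ Γ σ → ⟦ vars Γ (there {τ = σ}) ⟧ts ∘ ext Γ σ ≈ π₁
  ⟦weaken⟧∘ext Γ σ = proj-ext Γ λ x →
    ≈-trans (≈-sym (assoc _ _ (proj x))) (≈-trans (∘-congˡ (⟦vars⟧ Γ there x)) (proj-there∘ext Γ σ x))

  ⟦liftS⟧∘ext : ∀ {Γ Δ σ} (g : Terms Γ Δ) → ⟦ liftS {σ = σ} g ⟧ts ∘ ext Γ σ ≈ ext Δ σ ∘ (⟦ g ⟧ts ×₁ id)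
  ⟦liftS⟧∘ext {Γ} {Δ} {σ} g = begin
    ⟦ rens there g ▸ var here ⟧ts ∘ ext Γ σ
      ≈⟨ ∘-congˡ (⟦snoc⟧ (rens there g) (var here)) ⟩
    (ext Δ σ ∘ ⟨ ⟦ rens there g ⟧ts , x ⟩) ∘ ext Γ σ
      ≈⟨ assoc _ _ _ ⟩
    ext Δ σ ∘ (⟨ ⟦ rens there g ⟧ts , x ⟩ ∘ ext Γ σ)
      ≈⟨ ∘-congʳ (⟨⟩-∘ _ _ _) ⟩
    ext Δ σ ∘ ⟨ ⟦ rens there g ⟧ts ∘ ext Γ σ , x ∘ ext Γ σ ⟩
      ≈⟨ ∘-congʳ (⟨⟩-cong weakened (≈-trans (proj-here∘ext Γ σ) (≈-sym (idˡ π₂)))) ⟩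
    ext Δ σ ∘ (⟦ g ⟧ts ×₁ id) ∎
    where
      open HomReasoning
      x : Hom ⟦ Γ ▸ σ ⟧c (sortI σ)
      x = proj {Γ ▸ σ} here
      weakened : ⟦ rens there g ⟧ts ∘ ext Γ σ ≈ ⟦ g ⟧ts ∘ π₁
      weakened = begin
        ⟦ rens there g ⟧ts ∘ ext Γ σ              ≈⟨ ∘-congˡ (⟦rens⟧ there g) ⟩
        (⟦ g ⟧ts ∘ ⟦ vars Γ there ⟧ts) ∘ ext Γ σ  ≈⟨ assoc _ _ _ ⟩
        ⟦ g ⟧ts ∘ (⟦ vars Γ there ⟧ts ∘ ext Γ σ)  ≈⟨ ∘-congʳ (⟦weaken⟧∘ext Γ σ) ⟩
        ⟦ g ⟧ts ∘ π₁ ∎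

  ⟦subF⟧ : ∀ {Γ Δ} (g : Terms Γ Δ) (φ : Formula Δ) → ⟦ subF g φ ⟧f ≈ₚ act ⟦ g ⟧ts ⟦ φ ⟧f
  ⟦subF⟧ g (rel R Ms) = ≈ₚ.trans (act-cong (⟦subs⟧ g Ms) (relI R)) (act-∘ _ _ (relI R))
  ⟦subF⟧ g (eq σ M N) = ≈ₚ.trans (act-cong ⟦pair⟧ _) (act-∘ _ _ _)
    where
      ⟦pair⟧ : ⟨ ⟦ sub g M ⟧t , ⟦ sub g N ⟧t ⟩ ≈ ⟨ ⟦ M ⟧t , ⟦ N ⟧t ⟩ ∘ ⟦ g ⟧ts
      ⟦pair⟧ = ≈-trans (⟨⟩-cong (⟦sub⟧ g M) (⟦sub⟧ g N)) (≈-sym (⟨⟩-∘ _ _ _))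
  ⟦subF⟧ g (con k φs) =
    ≈ₚ.trans (op-cong k (λ i → ⟦subF⟧ g (φs i))) (≈ₚ.sym (act-op _ k _))
  ⟦subF⟧ {Γ} {Δ} g (quant q σ φ) = begin
    Ω q ⟦ Γ ⟧c (sortI σ) (act (ext Γ σ) ⟦ subF (liftS g) φ ⟧f)
      ≈⟨ Ω-cong q (act-resp-≈ₚ (ext Γ σ) (⟦subF⟧ (liftS g) φ)) ⟩
    Ω q ⟦ Γ ⟧c (sortI σ) (act (ext Γ σ) (act ⟦ liftS g ⟧ts ⟦ φ ⟧f))
      ≈⟨ Ω-cong q (≈ₚ.sym (act-∘ (ext Γ σ) ⟦ liftS g ⟧ts _)) ⟩
    Ω q ⟦ Γ ⟧c (sortI σ) (act (⟦ liftS g ⟧ts ∘ ext Γ σ) ⟦ φ ⟧f)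
      ≈⟨ Ω-cong q (act-cong (⟦liftS⟧∘ext g) _) ⟩
    Ω q ⟦ Γ ⟧c (sortI σ) (act (ext Δ σ ∘ (⟦ g ⟧ts ×₁ id)) ⟦ φ ⟧f)
      ≈⟨ Ω-cong q (act-∘ _ _ _) ⟩
    Ω q ⟦ Γ ⟧c (sortI σ) (act (⟦ g ⟧ts ×₁ id) (act (ext Δ σ) ⟦ φ ⟧f))
      ≈⟨ Ω-nat q _ _ ⟩
    act ⟦ g ⟧ts (Ω q ⟦ Δ ⟧c (sortI σ) (act (ext Δ σ) ⟦ φ ⟧f)) ∎
    where open PReasoning

module InternalEquivalence {ℓ} {L : Language ℓ} (A : RawPropCat L) (fa : IsFA A) where
  open RPC A
  open IsFA fa
  open IsCatWithProducts isCat
  open ProductLemmas cat isCat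
  open Internal A
  open Syntax L IntSig
  open SubstitutionLemmas L IntSig
  open Interp IntStr
  open Soundness A fa IntStr
  open Classifying Th Th-closure using (TEq; _⊢_)

  ≈⇒TEq : ∀ {Γ} Δ (f g : Terms Γ Δ) → ⟦ f ⟧ts ≈ ⟦ g ⟧ts → TEq f g
  ≈⇒TEq ε ε ε _ = tt
  ≈⇒TEq (ε ▸ σ) (ε ▸ M) (ε ▸ N) p = tt , p
  ≈⇒TEq ((Δ ▸ τ) ▸ σ) ((f ▸ M') ▸ M) ((g ▸ N') ▸ N) p =
    ≈⇒TEq (Δ ▸ τ) _ _ (≈-trans (≈-sym (π₁-β _ _)) (≈-trans (∘-congʳ p) (π₁-β _ _))) ,
    ≈-trans (≈-sym (π₂-β _ _)) (≈-trans (∘-congʳ p) (π₂-β _ _))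

  ≈ₚ⇒interderivable : ∀ {Γ} (φ ψ : Formula Γ) → ⟦ φ ⟧f ≈ₚ ⟦ ψ ⟧f → (φ ⊢ ψ) × (ψ ⊢ φ)
  ≈ₚ⇒interderivable {Γ} φ ψ p =
    Poset.reflexive (P ⟦ Γ ⟧c) p , Poset.reflexive (P ⟦ Γ ⟧c) (≈ₚ.sym p)

  x₀ : ∀ {c} → Terms (ε ▸ c) (ε ▸ c)
  x₀ = ε ▸ var here

  pairTerm : ∀ {b c} → Terms ((ε ▸ b) ▸ c) (ε ▸ (b ×ᵒ c))
  pairTerm = ε ▸ app id ((ε ▸ var (there here)) ▸ var here)

  ι : RawMorphism A CT
  ι = record { Fo = λ c → ε ▸ c ; Fh = λ f → ε ▸ app f x₀ ; Fp = λ R → rel R x₀ }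

  ι-isMorphism : IsMorphism ι
  ι-isMorphism = record
    { Fh-cong = λ p → tt , ∘-congˡ p
    ; Fh-id = tt , idˡ id
    ; Fh-∘ = λ f g → tt , assoc id f g
    ; 𝟙-inv = ε ▸ app id ε
    ; 𝟙-inv-l = tt
    ; 𝟙-inv-r = tt , ≈-trans (!-unique _) (≈-sym (!-unique id))
    ; ×-inv = λ b c → pairTerm
    ; ×-inv-l = λ b c → (tt , ≈-trans (∘-congʳ ⟦pairTerm⟧) (≈-trans (idʳ π₁) (≈-sym (idˡ π₁))))
                      , ≈-trans (∘-congʳ ⟦pairTerm⟧) (idʳ π₂)
    ; ×-inv-r = λ b c → tt , ≈-trans (idˡ _) (≈-sym (⟨⟩-unique id ≈-refl ≈-refl))
    ; Fp-mono = act-mono id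
    ; Fp-nat = λ f R → ≈ₚ⇒interderivable (rel (act f R) x₀) (rel R (ε ▸ app f x₀))
        (≈ₚ.trans (act-id _) (act-cong (≈-sym (idʳ f)) R))
    ; Fp-op = λ k Rs → ≈ₚ⇒interderivable (rel (op k Rs) x₀) (con k (λ i → rel (Rs i) x₀)) (act-op id k Rs)
    ; Fp-Ω = λ q b c R → ≈ₚ⇒interderivable (rel (Ω q b c R) x₀) (quant q c (rel R pairTerm))
        (≈ₚ.trans (act-id _) (Ω-cong q (≈ₚ.sym (⟦rel-pairTerm⟧ R))))
    ; Fp-Eq = λ c → ≈ₚ⇒interderivable (rel (Eq c) x₀) (eq c (app π₁ x₀) (app π₂ x₀))
        (act-cong (⟨⟩-unique id ≈-refl ≈-refl) _)
    }
    where
      ⟦pairTerm⟧ : ∀ {b c} → ⟦ pairTerm {b} {c} ⟧ts ≈ id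
      ⟦pairTerm⟧ = ≈-trans (idˡ _) ⟨id∘π₁,π₂⟩≈id

      ⟦rel-pairTerm⟧ : ∀ {b c} (R : ∣ b ×ᵒ c ∣) → act (ext (ε ▸ b) c) ⟦ rel R pairTerm ⟧f ≈ₚ R
      ⟦rel-pairTerm⟧ R = ≈ₚ.trans (act-id _)
                           (≈ₚ.trans (act-cong ⟦pairTerm⟧ R) (act-id R))

  Sbar∘ι≅id : TwoIso (Sbar ∘ᴹ ι) idᴹ
  Sbar∘ι≅id = record
    { η = λ c → id
    ; η-nat = λ f → ≈-sym (idˡ _)
    ; η-p = λ c R → ≈ₚ.refl
    ; η⁻¹ = λ c → id
    ; η⁻¹∘η = λ c → idˡ id
    ; η∘η⁻¹ = λ c → idˡ id
    }

  unpack : ∀ Γ → Terms (ε ▸ ⟦ Γ ⟧c) Γ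
  unpack Γ = tabulate Γ (λ x → app (proj x) x₀)

  pack : ∀ Γ → Terms Γ (ε ▸ ⟦ Γ ⟧c)
  pack Γ = ε ▸ app id (vars Γ (λ x → x))

  ⟦unpack⟧ : ∀ Γ → ⟦ unpack Γ ⟧ts ≈ id
  ⟦unpack⟧ Γ = proj-ext Γ λ x →
    ≈-trans (⟦lookup⟧ (unpack Γ) x) (≈-reflexive (≡.cong ⟦_⟧t (lookup-tabulate Γ _ x)))

  ⟦pack⟧ : ∀ Γ → ⟦ pack Γ ⟧ts ≈ id
  ⟦pack⟧ Γ = ≈-trans (idˡ _) (⟦vars-id⟧ Γ)

  ≈id⇒TEq-id : ∀ {Γ} (f : Terms Γ Γ) → ⟦ f ⟧ts ≈ id → TEq f (vars Γ (λ x → x))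
  ≈id⇒TEq-id {Γ} f p = ≈⇒TEq Γ _ _ (≈-trans p (≈-sym (⟦vars-id⟧ Γ)))

  ι∘Sbar≅id : TwoIso (ι ∘ᴹ Sbar) idᴹ
  ι∘Sbar≅id = record
    { η = unpack
    ; η-nat = λ {_} {Δ} f → ≈⇒TEq Δ _ _ (naturality f)
    ; η-p = λ Γ φ → ≈ₚ⇒interderivable (rel ⟦ φ ⟧f x₀) (subF (unpack Γ) φ)
        (≈ₚ.sym (≈ₚ.trans (⟦subF⟧ (unpack Γ) φ) (act-cong (⟦unpack⟧ Γ) _)))
    ; η⁻¹ = pack
    ; η⁻¹∘η = λ Γ → ≈id⇒TEq-id (subs (unpack Γ) (pack Γ))
        (≈-trans (⟦subs⟧ (unpack Γ) (pack Γ)) (≈-trans (∘-cong (⟦pack⟧ Γ) (⟦unpack⟧ Γ)) (idˡ id)))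
    ; η∘η⁻¹ = λ Γ → ≈id⇒TEq-id (subs (pack Γ) (unpack Γ))
        (≈-trans (⟦subs⟧ (pack Γ) (unpack Γ)) (≈-trans (∘-cong (⟦unpack⟧ Γ) (⟦pack⟧ Γ)) (idˡ id)))
    }
    where
      naturality : ∀ {Γ Δ} (f : Terms Γ Δ) →
                   ⟦ subs (unpack Γ) f ⟧ts ≈ ⟦ subs (ε ▸ app ⟦ f ⟧ts x₀) (unpack Δ) ⟧ts
      naturality {Γ} {Δ} f = begin
        ⟦ subs (unpack Γ) f ⟧ts                         ≈⟨ ⟦subs⟧ (unpack Γ) f ⟩
        ⟦ f ⟧ts ∘ ⟦ unpack Γ ⟧ts                        ≈⟨ ∘-congʳ (⟦unpack⟧ Γ) ⟩
        ⟦ f ⟧ts ∘ id                                    ≈⟨ ∘-congˡ (≈-sym (idˡ _)) ⟩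
        (id ∘ ⟦ f ⟧ts) ∘ id                             ≈⟨ ∘-congˡ (∘-congˡ (≈-sym (⟦unpack⟧ Δ))) ⟩
        (⟦ unpack Δ ⟧ts ∘ ⟦ f ⟧ts) ∘ id                 ≈⟨ assoc _ _ _ ⟩
        ⟦ unpack Δ ⟧ts ∘ (⟦ f ⟧ts ∘ id)                 ≈⟨ ≈-sym (⟦subs⟧ _ (unpack Δ)) ⟩
        ⟦ subs (ε ▸ app ⟦ f ⟧ts x₀) (unpack Δ) ⟧ts ∎
        where open HomReasoning

mainTheorem7 : ∀ {ℓ : Level} {L : Language ℓ} (A : RawPropCat L) → IsFA A →
    Σ (RawMorphism A (Internal.CT A)) λ ι →
    IsMorphism ι
    × TwoIso (Internal.Sbar A ∘ᴹ ι) idᴹ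
    × TwoIso (ι ∘ᴹ Internal.Sbar A) idᴹ
mainTheorem7 A fa = ι , ι-isMorphism , Sbar∘ι≅id , ι∘Sbar≅id
  where open InternalEquivalence A fa
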